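{- Let $G$ be a graph, let $a,b,k\ge 0$ be integers, and let $\mathcal{A}$ be a set of pairwise disjoint nonempty subsets of $V(G)$, with union $W$, such that each $A\in\mathcal{A}$ has quasi-bound at most $(a,b)$. Suppose there is a line-decomposition of $G[W]$ in which each bag is the union of at most $k$ members of $\mathcal{A}$. Then $G[W]$ has quasi-line-width at most $((k+1)a,b)$.
   Context: Graphs may be infinite and have no loops or parallel edges. All distances are measured in $G$ (never in subgraphs). A line-decomposition of a graph $J$ is a family $(B_t:t\in T)$ of subsets of $V(J)$ indexed by a linearly ordered set $T$ such that $\bigcup_t B_t=V(J)$, every edge has both ends in some $B_t$, and $B_{t_1}\cap B_{t_3}\subseteq B_{t_2}$ whenever $t_1<t_2<t_3$. $X\subseteq V(G)$ has quasi-size at most $(k,r)$ if there is $Y\subseteq V(G)$ with $|Y|\le k$ and $\operatorname{dist}_G(x,Y)\le r$ for all $x\in X$. For $X\subseteq V(G)$, $G[X]$ (or $X$) has quasi-line-width at most $(k,r)$ if $G[X]$ admits a line-decomposition each of whose bags has quasi-size at most $(k,r)$ (in $G$). $\operatorname{bd}(X)$ is the set of vertices of $X$ having a neighbour in $V(G)\setminus X$. $X$ has quasi-bound at most $(a,b)$ if $G[X]$ has quasi-line-width at most $(a,b)$ and $\operatorname{bd}(X)$ has quasi-size at most $(a,b)$. -}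

module Defs where

open import Data.Nat using (ℕ; zero; suc; _≤_)
open import Data.List using (List; length)
open import Data.List.Membership.Propositional using (_∈_)
open import Data.Product using (Σ; ∃; _×_; _,_)
open import Data.Empty using (⊥)
open import Relation.Nullary using (¬_)
open import Relation.Binary.PropositionalEquality using (_≡_)
open import Relation.Binary.Structures using (IsStrictTotalOrder)

record Graph : Set₁ where
  field
    V      : Set
    Adj    : V → V → Set
    sym    : ∀ {x y} → Adj x y → Adj y x
    irrefl : ∀ {x} → ¬ Adj x x

Subset : Graph → Set₁
Subset G = Graph.V G → Set

module _ (G : Graph) where
  open Graph G

  -- Reach x y n : there is a walk in G from x to y of length at most n.
  data Reach : V → V → ℕ → Set where
    here  : ∀ {x n} → Reach x x n
    there : ∀ {x z y n} → Adj x z → Reach z y n → Reach x y (suc n)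

  -- dist_G(x, Y) ≤ r, for a finite set Y given as a list.
  DistLe : V → List V → ℕ → Set
  DistLe x Y r = ∃ λ y → y ∈ Y × Reach x y r

  QuasiSize : Subset G → ℕ → ℕ → Set
  QuasiSize X k r = Σ (List V) λ Y → length Y ≤ k × (∀ x → X x → DistLe x Y r)

  record LineDecomposition (X : Subset G) : Set₁ where
    field
      T      : Set
      _<_    : T → T → Set
      isSTO  : IsStrictTotalOrder _≡_ _<_
      Bag    : T → Subset G
      bagSub : ∀ t x → Bag t x → X x
      cover  : ∀ x → X x → ∃ λ t → Bag t x
      edges  : ∀ x y → X x → X y → Adj x y → ∃ λ t → Bag t x × Bag t y
      interp : ∀ t₁ t₂ t₃ x → t₁ < t₂ → t₂ < t₃ → Bag t₁ x → Bag t₃ x → Bag t₂ x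

  QuasiLineWidth : Subset G → ℕ → ℕ → Set₁
  QuasiLineWidth X k r =
    Σ (LineDecomposition X) λ D → ∀ t → QuasiSize (LineDecomposition.Bag D t) k r

  bd : Subset G → Subset G
  bd X x = X x × ∃ λ y → Adj x y × ¬ X y

  QuasiBound : Subset G → ℕ → ℕ → Set₁
  QuasiBound X a b = QuasiLineWidth X a b × QuasiSize (bd X) a b

-- Fix for every part A a home: a bag of D whose list contains A. Refine D lexicographically: each
-- bag B_t becomes one slot per part in its list, and the slot of A at A's home is expanded along the
-- line-decomposition of A. A refined bag is B_t ∩ ⋃ bd(A) together with, in a home slot, one bag of
-- that part's decomposition. A boundary vertex then occupies an interval of slots because it does in
-- D, any other vertex occurs only in the home slots of its own part, and an edge between two parts
-- has both ends in boundaries, so the slots of a bag of D containing it cover it. A refined bag is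
-- near the a centres of one inner bag and the a centres of each of the ≤ k boundaries meeting B_t.
module Submission where

open import Defs
open import Data.Nat using (ℕ; suc; _*_; _+_; _≤_; z≤n)
open import Data.Nat.Properties using (+-mono-≤; +-monoʳ-≤; *-monoˡ-≤; ≤-refl; ≤-trans)
open import Data.List using (List; []; _∷_; _++_; length; lookup)
open import Data.List.Properties using (length-++)
open import Data.List.Membership.Propositional using (_∈_)
open import Data.List.Membership.Propositional.Properties using (∈-++⁺ˡ; ∈-++⁺ʳ; ∈-lookup)
open import Data.List.Relation.Unary.Any using (here; there; index)
open import Data.List.Relation.Unary.Any.Properties using (lookup-index)
open import Data.Fin as Fin using (Fin)
open import Data.Fin.Properties using (<-isStrictTotalOrder)
open import Data.Product using (Σ; ∃; _×_; _,_; proj₁; proj₂)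
open import Data.Sum using (_⊎_; inj₁; inj₂; [_,_]′)
open import Data.Empty using (⊥-elim)
open import Function using (_∘_)
open import Function.Bundles using (mk↣)
open import Relation.Nullary using (¬_; yes; no)
open import Relation.Nullary.Decidable using (via-injection)
open import Relation.Unary using (_⊆_; _∪_)
open import Relation.Binary.Definitions using (DecidableEquality; Tri; tri<; tri≈; tri>)
open import Relation.Binary.Structures using (IsStrictTotalOrder)
open import Relation.Binary.PropositionalEquality
  using (_≡_; refl; sym; cong; subst; isEquivalence; resp₂; module ≡-Reasoning)
import Relation.Binary.Construct.StrictToNonStrict as StrictToNonStrict

Interpolates : {T V : Set} → (T → T → Set) → (T → V → Set) → Set
Interpolates _<_ B = ∀ t₁ t₂ t₃ x → t₁ < t₂ → t₂ < t₃ → B t₁ x → B t₃ x → B t₂ x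

module _ {T V : Set} {_<_ : T → T → Set} where

  open StrictToNonStrict _≡_ _<_ using () renaming (_≤_ to _≼_)

  interpolates-≤ : ∀ {B : T → V → Set} → Interpolates _<_ B →
                   ∀ {t₁ t₂ t₃ x} → t₁ ≼ t₂ → t₂ ≼ t₃ → B t₁ x → B t₃ x → B t₂ x
  interpolates-≤ B-int (inj₂ refl) _           x∈B₁ _    = x∈B₁
  interpolates-≤ B-int (inj₁ _)    (inj₂ refl) _    x∈B₃ = x∈B₃
  interpolates-≤ B-int (inj₁ t₁<t₂) (inj₁ t₂<t₃) x∈B₁ x∈B₃ = B-int _ _ _ _ t₁<t₂ t₂<t₃ x∈B₁ x∈B₃

  interpolates-∘ : ∀ {T′ : Set} {_<′_ : T′ → T′ → Set} {B : T → V → Set} (f : T′ → T) →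
                   (∀ {u v} → u <′ v → f u ≼ f v) →
                   Interpolates _<_ B → Interpolates _<′_ (λ u → B (f u))
  interpolates-∘ f f-mono B-int _ _ _ _ u₁<u₂ u₂<u₃ =
    interpolates-≤ B-int (f-mono u₁<u₂) (f-mono u₂<u₃)

  -- Q ⊆ B is what lets a vertex switch between the two kinds of bag.
  interpolates-∪ : ∀ {B Q : T → V → Set} (R : V → Set) →
                   Interpolates _<_ B → Interpolates _<_ Q →
                   (∀ {t x} → Q t x → B t x) →
                   Interpolates _<_ (λ t x → (B t x × R x) ⊎ Q t x)
  interpolates-∪ R B-int Q-int Q⊆B t₁ t₂ t₃ x t₁<t₂ t₂<t₃ (inj₁ (x∈B₁ , Rx)) x∈N₃ =
    inj₁ (B-int t₁ t₂ t₃ x t₁<t₂ t₂<t₃ x∈B₁ ([ proj₁ , Q⊆B ]′ x∈N₃) , Rx)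
  interpolates-∪ R B-int Q-int Q⊆B t₁ t₂ t₃ x t₁<t₂ t₂<t₃ (inj₂ x∈Q₁) (inj₁ (x∈B₃ , Rx)) =
    inj₁ (B-int t₁ t₂ t₃ x t₁<t₂ t₂<t₃ (Q⊆B x∈Q₁) x∈B₃ , Rx)
  interpolates-∪ R B-int Q-int Q⊆B t₁ t₂ t₃ x t₁<t₂ t₂<t₃ (inj₂ x∈Q₁) (inj₂ x∈Q₃) =
    inj₂ (Q-int t₁ t₂ t₃ x t₁<t₂ t₂<t₃ x∈Q₁ x∈Q₃)

module ΣLex {A : Set} {B : A → Set} (_<₁_ : A → A → Set) (_<₂_ : ∀ {a} → B a → B a → Set)
            (sto₁ : IsStrictTotalOrder _≡_ _<₁_)
            (sto₂ : ∀ {a} → IsStrictTotalOrder _≡_ (_<₂_ {a})) where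

  private
    module O₁ = IsStrictTotalOrder sto₁
    module O₂ {a} = IsStrictTotalOrder (sto₂ {a})

  data _<ₗₑₓ_ : Σ A B → Σ A B → Set where
    fst< : ∀ {a a′ x y} → a <₁ a′ → (a , x) <ₗₑₓ (a′ , y)
    snd< : ∀ {a x y} → x <₂ y → (a , x) <ₗₑₓ (a , y)

  irrefl : ∀ {p q} → p ≡ q → ¬ (p <ₗₑₓ q)
  irrefl refl (fst< a<a) = O₁.irrefl refl a<a
  irrefl refl (snd< x<x) = O₂.irrefl refl x<x

  trans : ∀ {p q r} → p <ₗₑₓ q → q <ₗₑₓ r → p <ₗₑₓ r
  trans (fst< a<b) (fst< b<c) = fst< (O₁.trans a<b b<c)
  trans (fst< a<b) (snd< _)   = fst< a<b
  trans (snd< _)   (fst< a<c) = fst< a<c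
  trans (snd< x<y) (snd< y<z) = snd< (O₂.trans x<y y<z)

  private
    tri-< : ∀ {p q} → p <ₗₑₓ q → Tri (p <ₗₑₓ q) (p ≡ q) (q <ₗₑₓ p)
    tri-< p<q = tri< p<q (λ p≡q → irrefl p≡q p<q) (λ q<p → irrefl refl (trans p<q q<p))

    tri-> : ∀ {p q} → q <ₗₑₓ p → Tri (p <ₗₑₓ q) (p ≡ q) (q <ₗₑₓ p)
    tri-> q<p = tri> (λ p<q → irrefl refl (trans p<q q<p)) (λ p≡q → irrefl (sym p≡q) q<p) q<p

  compare : ∀ p q → Tri (p <ₗₑₓ q) (p ≡ q) (q <ₗₑₓ p)
  compare (a , x) (b , y) with O₁.compare a b
  ... | tri< a<b _ _ = tri-< (fst< a<b)
  ... | tri> _ _ b<a = tri-> (fst< b<a)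
  ... | tri≈ _ refl _ with O₂.compare x y
  ...   | tri< x<y _ _  = tri-< (snd< x<y)
  ...   | tri≈ _ refl _ = tri≈ (irrefl refl) refl (irrefl refl)
  ...   | tri> _ _ y<x  = tri-> (snd< y<x)

  isStrictTotalOrder : IsStrictTotalOrder _≡_ _<ₗₑₓ_
  isStrictTotalOrder = record
    { isStrictPartialOrder = record
      { isEquivalence = isEquivalence
      ; irrefl        = irrefl
      ; trans         = trans
      ; <-resp-≈      = resp₂ _<ₗₑₓ_
      }
    ; compare = compare
    }

  open IsStrictTotalOrder isStrictTotalOrder public using (_≟_)

  open StrictToNonStrict _≡_ _<₁_ using () renaming (_≤_ to _≼₁_)

  proj₁-monotone : ∀ {p q} → p <ₗₑₓ q → proj₁ p ≼₁ proj₁ q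
  proj₁-monotone (fst< a<b) = inj₁ a<b
  proj₁-monotone (snd< _)   = inj₂ refl

  Σ-interpolates : ∀ {V : Set} (C : (a : A) → B a → V → Set) →
                   (∀ a → Interpolates _<₂_ (C a)) →
                   (∀ {a b s u x} → C a s x → C b u x → a ≡ b) →
                   Interpolates _<ₗₑₓ_ (λ p → C (proj₁ p) (proj₂ p))
  Σ-interpolates C C-int same-fibre _ _ _ x p₁<p₂ p₂<p₃ x∈C₁ x∈C₃ with same-fibre x∈C₁ x∈C₃
  Σ-interpolates C C-int same-fibre _ _ _ x (fst< a<b) (fst< b<a) _ _ | refl =
    ⊥-elim (O₁.asym a<b b<a)
  Σ-interpolates C C-int same-fibre _ _ _ x (fst< a<a) (snd< _) _ _ | refl =
    ⊥-elim (O₁.irrefl refl a<a)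
  Σ-interpolates C C-int same-fibre _ _ _ x (snd< _) (fst< a<a) _ _ | refl =
    ⊥-elim (O₁.irrefl refl a<a)
  Σ-interpolates C C-int same-fibre (a , s₁) (_ , s₂) (_ , s₃) x
    (snd< s₁<s₂) (snd< s₂<s₃) x∈C₁ x∈C₃ | refl = C-int a s₁ s₂ s₃ x s₁<s₂ s₂<s₃ x∈C₁ x∈C₃

module _ (G : Graph) where

  quasiSize-mono : ∀ {X Y : Subset G} {k l r} → X ⊆ Y → k ≤ l →
                   QuasiSize G Y k r → QuasiSize G X l r
  quasiSize-mono X⊆Y k≤l (Y , |Y|≤k , near) =
    Y , ≤-trans |Y|≤k k≤l , λ x x∈X → near x (X⊆Y x∈X)

  quasiSize-∪ : ∀ {X Y : Subset G} {k l r} →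
                QuasiSize G X k r → QuasiSize G Y l r → QuasiSize G (X ∪ Y) (k + l) r
  quasiSize-∪ {X} {Y} {k} {l} {r} (Z₁ , |Z₁|≤k , near₁) (Z₂ , |Z₂|≤l , near₂) =
    Z₁ ++ Z₂ , |Z₁++Z₂|≤k+l , near
    where
    |Z₁++Z₂|≤k+l : length (Z₁ ++ Z₂) ≤ k + l
    |Z₁++Z₂|≤k+l rewrite length-++ Z₁ {Z₂} = +-mono-≤ |Z₁|≤k |Z₂|≤l
    near : ∀ x → (X ∪ Y) x → DistLe G x (Z₁ ++ Z₂) r
    near x (inj₁ x∈X) = let (z , z∈Z₁ , x→z) = near₁ x x∈X in z , ∈-++⁺ˡ z∈Z₁ , x→z
    near x (inj₂ x∈Y) = let (z , z∈Z₂ , x→z) = near₂ x x∈Y in z , ∈-++⁺ʳ Z₁ z∈Z₂ , x→z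

  quasiSize-⋃ : ∀ {I : Set} {a r} (X : I → Subset G) (is : List I) →
                (∀ i → QuasiSize G (X i) a r) →
                QuasiSize G (λ x → ∃ λ i → i ∈ is × X i x) (length is * a) r
  quasiSize-⋃ X []       X-size = [] , z≤n , λ { x (_ , () , _) }
  quasiSize-⋃ X (i ∷ is) X-size =
    quasiSize-mono split ≤-refl (quasiSize-∪ (X-size i) (quasiSize-⋃ X is X-size))
    where
    split : (λ x → ∃ λ j → j ∈ i ∷ is × X j x) ⊆ (X i ∪ (λ x → ∃ λ j → j ∈ is × X j x))
    split (_ , here refl , x∈Xᵢ) = inj₁ x∈Xᵢ
    split (j , there j∈is , x∈Xⱼ) = inj₂ (j , j∈is , x∈Xⱼ)

module Refinement (G : Graph) (a r k : ℕ) (I : Set) (A : I → Subset G)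
  (disjoint : ∀ i j x → A i x → A j x → i ≡ j)
  (nonempty : ∀ i → ∃ λ x → A i x)
  (quasiBound : ∀ i → QuasiBound G (A i) a r)
  (D : LineDecomposition G (λ x → ∃ λ i → A i x))
  (bagParts : ∀ t → Σ (List I) λ L → length L ≤ k
          × (∀ x → LineDecomposition.Bag D t x → ∃ λ i → i ∈ L × A i x)
          × (∀ x i → i ∈ L → A i x → LineDecomposition.Bag D t x)) where

  open Graph G using (Adj)
  open LineDecomposition D

  W : Subset G
  W x = ∃ λ i → A i x

  parts : T → List I
  parts t = proj₁ (bagParts t)

  bag⇒part : ∀ {t x} → Bag t x → ∃ λ i → i ∈ parts t × A i x
  bag⇒part = proj₁ (proj₂ (proj₂ (bagParts _))) _

  part⇒bag : ∀ {t x i} → i ∈ parts t → A i x → Bag t x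
  part⇒bag = proj₂ (proj₂ (proj₂ (bagParts _))) _ _

  parts-length : ∀ t → length (parts t) ≤ k
  parts-length t = proj₁ (proj₂ (bagParts t))

  boundary-size : ∀ i → QuasiSize G (bd G (A i)) a r
  boundary-size i = proj₂ (quasiBound i)

  part-in-bag : ∀ {t x i} → Bag t x → A i x → i ∈ parts t
  part-in-bag {t} x∈Bₜ x∈Aᵢ =
    let (j , j∈parts , x∈Aⱼ) = bag⇒part x∈Bₜ
    in subst (_∈ parts t) (disjoint j _ _ x∈Aⱼ x∈Aᵢ) j∈parts

  module Dᵢ (i : I) = LineDecomposition (proj₁ (proj₁ (quasiBound i)))

  Dᵢ-width : ∀ i s → QuasiSize G (Dᵢ.Bag i s) a r
  Dᵢ-width i = proj₂ (proj₁ (quasiBound i))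

  slot : (i : I) → Dᵢ.T i
  slot i = let (x , x∈Aᵢ) = nonempty i in proj₁ (Dᵢ.cover i x x∈Aᵢ)

  Base : Set
  Base = Σ T λ t → Fin (length (parts t))

  module BaseLex =
    ΣLex {B = λ t → Fin (length (parts t))} _<_ Fin._<_ isSTO <-isStrictTotalOrder

  part : Base → I
  part (t , p) = lookup (parts t) p

  homeBag : (i : I) → ∃ λ t → i ∈ parts t
  homeBag i = let (x , x∈Aᵢ) = nonempty i ; (t , x∈Bₜ) = cover x (i , x∈Aᵢ)
              in t , part-in-bag x∈Bₜ x∈Aᵢ

  home : I → Base
  home i = proj₁ (homeBag i) , index (proj₂ (homeBag i))

  part-home : ∀ i → part (home i) ≡ i
  part-home i = sym (lookup-index (proj₂ (homeBag i)))

  _≟ᴵ_ : DecidableEquality I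
  _≟ᴵ_ = via-injection (mk↣ home-injective) BaseLex._≟_
    where
    home-injective : ∀ {i j} → home i ≡ home j → i ≡ j
    home-injective {i} {j} eq = begin
      i                ≡⟨ sym (part-home i) ⟩
      part (home i)    ≡⟨ cong part eq ⟩
      part (home j)    ≡⟨ part-home j ⟩
      j                ∎
      where open ≡-Reasoning

  Index : Set
  Index = Σ Base λ β → Dᵢ.T (part β)

  module IndexLex =
    ΣLex {B = λ β → Dᵢ.T (part β)} BaseLex._<ₗₑₓ_ (λ {β} → Dᵢ._<_ (part β))
         BaseLex.isStrictTotalOrder (λ {β} → Dᵢ.isSTO (part β))

  outer : Index → T
  outer u = proj₁ (proj₁ u)

  Boundary : Subset G
  Boundary x = ∃ λ i → bd G (A i) x

  Inner : (β : Base) → Dᵢ.T (part β) → Subset G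
  Inner β s x = home (part β) ≡ β × Dᵢ.Bag (part β) s x

  RefinedBag : Index → Subset G
  RefinedBag u x = (Bag (outer u) x × Boundary x) ⊎ Inner (proj₁ u) (proj₂ u) x

  inner⊆bag : ∀ {β s x} → Inner β s x → Bag (proj₁ β) x
  inner⊆bag {β} {s} {x} (_ , x∈Bₛ) =
    part⇒bag (∈-lookup (proj₂ β)) (Dᵢ.bagSub (part β) s x x∈Bₛ)

  inner-same-home : ∀ {β γ s s′ x} → Inner β s x → Inner γ s′ x → β ≡ γ
  inner-same-home {β} {γ} {s} {s′} {x} (homeβ , x∈Bₛ) (homeγ , x∈Bₛ′) = begin
    β              ≡⟨ sym homeβ ⟩
    home (part β)  ≡⟨ cong home (disjoint _ _ x (Dᵢ.bagSub _ s x x∈Bₛ) (Dᵢ.bagSub _ s′ x x∈Bₛ′)) ⟩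
    home (part γ)  ≡⟨ homeγ ⟩
    γ              ∎
    where open ≡-Reasoning

  toHome : ∀ {i} → Dᵢ.T i → Dᵢ.T (part (home i))
  toHome {i} = subst Dᵢ.T (sym (part-home i))

  inner-at-home : ∀ {i s x} → Dᵢ.Bag i s x → Inner (home i) (toHome s) x
  inner-at-home {i} x∈Bₛ with part (home i) | part-home i
  ... | _ | refl = refl , x∈Bₛ

  boundary-of-edge : ∀ {i j x y} → A i x → A j y → Adj x y → ¬ i ≡ j → bd G (A i) x
  boundary-of-edge {i} {j} {x} {y} x∈Aᵢ y∈Aⱼ x~y i≢j =
    x∈Aᵢ , y , x~y , λ y∈Aᵢ → i≢j (disjoint i j y y∈Aᵢ y∈Aⱼ)

  refined-interp : Interpolates IndexLex._<ₗₑₓ_ RefinedBag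
  refined-interp = interpolates-∪ Boundary outer-interp inner-interp inner⊆bag
    where
    outer-interp : Interpolates IndexLex._<ₗₑₓ_ (λ u → Bag (outer u))
    outer-interp = interpolates-∘ proj₁ IndexLex.proj₁-monotone
                     (interpolates-∘ proj₁ BaseLex.proj₁-monotone interp)
    inner-interp : Interpolates IndexLex._<ₗₑₓ_ (λ u → Inner (proj₁ u) (proj₂ u))
    inner-interp = IndexLex.Σ-interpolates Inner
      (λ β s₁ s₂ s₃ x s₁<s₂ s₂<s₃ (homeβ , x∈B₁) (_ , x∈B₃) →
         homeβ , Dᵢ.interp (part β) s₁ s₂ s₃ x s₁<s₂ s₂<s₃ x∈B₁ x∈B₃)
      inner-same-home

  refinement : LineDecomposition G W
  refinement = record
    { T      = Index
    ; _<_    = IndexLex._<ₗₑₓ_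
    ; isSTO  = IndexLex.isStrictTotalOrder
    ; Bag    = RefinedBag
    ; bagSub = bagSub′
    ; cover  = cover′
    ; edges  = edges′
    ; interp = refined-interp
    }
    where
    bagSub′ : ∀ u x → RefinedBag u x → W x
    bagSub′ u x (inj₁ (x∈B , _))   = bagSub (outer u) x x∈B
    bagSub′ (β , s) x (inj₂ (_ , x∈Bₛ)) = part β , Dᵢ.bagSub (part β) s x x∈Bₛ

    cover′ : ∀ x → W x → ∃ λ u → RefinedBag u x
    cover′ x (i , x∈Aᵢ) =
      let (s , x∈Bₛ) = Dᵢ.cover i x x∈Aᵢ in (home i , toHome s) , inj₂ (inner-at-home x∈Bₛ)

    edges′ : ∀ x y → W x → W y → Adj x y → ∃ λ u → RefinedBag u x × RefinedBag u y
    edges′ x y (i , x∈Aᵢ) (j , y∈Aⱼ) x~y with i ≟ᴵ j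
    ... | yes refl =
      let (s , x∈Bₛ , y∈Bₛ) = Dᵢ.edges i x y x∈Aᵢ y∈Aⱼ x~y
      in (home i , toHome s) , inj₂ (inner-at-home x∈Bₛ) , inj₂ (inner-at-home y∈Bₛ)
    ... | no i≢j =
      let (τ , x∈Bτ , y∈Bτ) = edges x y (i , x∈Aᵢ) (j , y∈Aⱼ) x~y
      in ((τ , index (part-in-bag x∈Bτ x∈Aᵢ)) , slot _)
         , inj₁ (x∈Bτ , i , boundary-of-edge x∈Aᵢ y∈Aⱼ x~y i≢j)
         , inj₁ (y∈Bτ , j , boundary-of-edge y∈Aⱼ x∈Aᵢ (Graph.sym G x~y) (i≢j ∘ sym))

  refinement-width : ∀ u → QuasiSize G (RefinedBag u) (suc k * a) r
  refinement-width ((τ , p) , s) =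
    quasiSize-mono G split (+-monoʳ-≤ a (*-monoˡ-≤ a (parts-length τ)))
      (quasiSize-∪ G (Dᵢ-width _ s) (quasiSize-⋃ G (λ i → bd G (A i)) (parts τ) boundary-size))
    where
    split : RefinedBag ((τ , p) , s) ⊆
            (Dᵢ.Bag (part (τ , p)) s ∪ λ x → ∃ λ i → i ∈ parts τ × bd G (A i) x)
    split (inj₁ (x∈B , i , x∈bdAᵢ)) = inj₂ (i , part-in-bag x∈B (proj₁ x∈bdAᵢ) , x∈bdAᵢ)
    split (inj₂ (_ , x∈Bₛ))        = inj₁ x∈Bₛ

mainTheorem6 : (G : Graph) (a b k : ℕ)
    (I : Set) (A : I → Subset G)
    → (∀ i j x → A i x → A j x → i ≡ j)
    → (∀ i → ∃ λ x → A i x)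
    → (∀ i → QuasiBound G (A i) a b)
    → (D : LineDecomposition G (λ x → ∃ λ i → A i x))
    → (∀ t → Σ (List I) λ L → length L ≤ k
          × (∀ x → LineDecomposition.Bag D t x → ∃ λ i → i ∈ L × A i x)
          × (∀ x i → i ∈ L → A i x → LineDecomposition.Bag D t x))
    → QuasiLineWidth G (λ x → ∃ λ i → A i x) (suc k * a) b
mainTheorem6 G a b k I A disjoint nonempty quasiBound D bagParts = refinement , refinement-width
  where open Refinement G a b k I A disjoint nonempty quasiBound D bagParts
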